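{- Let $\phi=\{a_1,\dots,a_n\}$ and let $\sigma\in S_n=\mathrm{Sym}(\phi)$ be written as a product of $r$ disjoint cycles $\sigma=\tau_1\cdots\tau_r$, where $\tau_i$ is a $k_i$-cycle with $k_i\ge2$ and $k_1+\cdots+k_r=n$. Let $d\ge2$, let $x_1,\dots,x_d$ be new points and $S_{n+d}=\mathrm{Sym}(\phi\cup\{x_1,\dots,x_d\})$. Then any expression of $\sigma^{ -1}$ as a product of $3$-cycles of $S_{n+d}$, each moving at least one of $x_1,\dots,x_d$, has at least $\frac{n+r}{2}$ factors.
   Context: Products are compositions, rightmost applied first. -}

module Defs where

open import Data.Nat using (ℕ; zero; suc; _<?_)
open import Data.Fin using (Fin; zero; suc; toℕ; fromℕ<)
open import Data.Fin.Permutation using (Permutation′; _⟨$⟩ʳ_)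
open import Data.List using (List; []; _∷_)
open import Data.Product using (Σ; _×_)
open import Function.Definitions using (Injective)
open import Relation.Binary.PropositionalEquality using (_≡_; _≢_)
open import Relation.Nullary using (yes; no)

next : ∀ {k} → Fin k → Fin k
next {suc k} j with suc (toℕ j) <? suc k
... | yes p = fromℕ< p
... | no _  = zero

IsCycle : ∀ {m} → Permutation′ m → ℕ → Set
IsCycle {m} π k =
  Σ (Fin k → Fin m) λ c →
    Injective _≡_ _≡_ c
    × (∀ j → π ⟨$⟩ʳ c j ≡ c (next j))
    × (∀ x → (∀ j → c j ≢ x) → π ⟨$⟩ʳ x ≡ x)

applyProd : ∀ {m} → List (Permutation′ m) → Fin m → Fin m
applyProd []       x = x
applyProd (π ∷ πs) x = π ⟨$⟩ʳ applyProd πs x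

-- Let N p count the factors of the word that move the old point p. A 3-cycle that moves a
-- new point moves at most two old points, so Σ N ≤ 2 · (number of factors). Every point of a
-- k-cycle c₀ … c_{k-1} of σ is moved by some factor. If each were moved by exactly one, then,
-- as the word sends c_{j+1} to c_j, the factor moving c_j would sit no further right in the
-- word than the one moving c_{j+1}; going around the cycle, two consecutive such factors
-- coincide, and that single 3-cycle sends c_{j+2} ↦ c_{j+1} ↦ c_j, leaving no room in its
-- support for a new point. So each cycle contributes at least k + 1, and Σ N ≥ n + r.
module Submission where

open import Defs
open import Data.Nat using (ℕ; zero; suc; _+_; _*_; _∸_; _≤_; _<_; z≤n; s≤s; _≤?_; _<?_)
open import Data.Nat.Properties
open import Data.Fin using (Fin; zero; suc; toℕ; _↑ˡ_; _↑ʳ_; splitAt) renaming (_≟_ to _≟ᶠ_)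
open import Data.Fin.Properties
  using (any?; ↑ˡ-injective; splitAt-↑ˡ; splitAt-↑ʳ; toℕ-fromℕ<) renaming (suc-injective to suc-injectiveᶠ)
open import Data.Fin.Permutation using (Permutation′; _⟨$⟩ʳ_; _⟨$⟩ˡ_; inverseˡ)
open import Data.List using (List; []; _∷_; length; tabulate; map; take; drop; _++_)
open import Data.List.Properties using (take++drop≡id; drop-drop; ∷-injectiveˡ; map-++)
open import Data.Nat.ListAction using (sum)
open import Data.Nat.ListAction.Properties using (sum-++)
open import Data.List.Relation.Unary.All using (All; []; _∷_)
open import Data.List.Relation.Unary.All.Properties using (drop⁺)
open import Data.Product using (Σ; ∃-syntax; _×_; _,_; proj₁; proj₂)
open import Data.Sum using (_⊎_; inj₁; inj₂)
open import Data.Empty using (⊥; ⊥-elim)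
open import Function using (_∘_; case_of_)
open import Function.Definitions using (Injective)
open import Relation.Nullary using (yes; no; ¬_; contradiction)
open import Relation.Binary.PropositionalEquality
open import Algebra.Properties.Semiring.Sum +-*-semiring
  using (sum-syntax; ∑-comm; ∑-distrib-+; *-distribʳ-sum) renaming (sum to ∑; sum-cong-≗ to ∑-cong)

∑-mono-≤ : ∀ {m} {f g : Fin m → ℕ} → (∀ i → f i ≤ g i) → ∑ f ≤ ∑ g
∑-mono-≤ {zero}  f≤g = z≤n
∑-mono-≤ {suc m} f≤g = +-mono-≤ (f≤g zero) (∑-mono-≤ (f≤g ∘ suc))

∑-zero : ∀ {m} {f : Fin m → ℕ} → (∀ i → f i ≡ 0) → ∑ f ≡ 0
∑-zero {zero}  f≡0 = refl
∑-zero {suc m} f≡0 = cong₂ _+_ (f≡0 zero) (∑-zero (f≡0 ∘ suc))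

∑-suc : ∀ {m} (f : Fin m → ℕ) → ∑[ i < m ] suc (f i) ≡ m + ∑ f
∑-suc {zero}  f = refl
∑-suc {suc m} f = cong suc (begin
  f zero + ∑[ i < m ] suc (f (suc i)) ≡⟨ cong (f zero +_) (∑-suc (f ∘ suc)) ⟩
  f zero + (m + ∑ (f ∘ suc))          ≡⟨ +-assoc (f zero) m _ ⟨
  f zero + m + ∑ (f ∘ suc)            ≡⟨ cong (_+ ∑ (f ∘ suc)) (+-comm (f zero) m) ⟩
  m + f zero + ∑ (f ∘ suc)            ≡⟨ +-assoc m (f zero) _ ⟩
  m + (f zero + ∑ (f ∘ suc))          ∎)
  where open ≡-Reasoning

∑-positive : ∀ {m} {f : Fin m → ℕ} → (∀ i → 0 < f i) → m ≤ ∑ f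
∑-positive {zero}  _   = z≤n
∑-positive {suc m} f>0 = +-mono-≤ (f>0 zero) (∑-positive (f>0 ∘ suc))

∑-positive-with-two : ∀ {m} {f : Fin m → ℕ} → (∀ i → 0 < f i) → (j : Fin m) → 2 ≤ f j → suc m ≤ ∑ f
∑-positive-with-two f>0 zero    f₀≥2 = +-mono-≤ f₀≥2 (∑-positive (f>0 ∘ suc))
∑-positive-with-two f>0 (suc j) fⱼ≥2 = +-mono-≤ (f>0 zero) (∑-positive-with-two (f>0 ∘ suc) j fⱼ≥2)

∑-pos : ∀ {m} (f : Fin m → ℕ) → 0 < ∑ f → ∃[ i ] 0 < f i
∑-pos {suc m} f ∑f>0 with f zero in f₀≡
... | suc _ = zero , ≤-trans (s≤s z≤n) (≤-reflexive (sym f₀≡))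
... | zero  with ∑-pos (f ∘ suc) ∑f>0
...   | i , fᵢ>0 = suc i , fᵢ>0

∑-≤1 : ∀ {m} {f : Fin m → ℕ} → (∀ i → f i ≤ 1) → (∀ i j → 0 < f i → 0 < f j → i ≡ j) →
  ∑ f ≤ 1
∑-≤1 {zero}      f≤1 unique = z≤n
∑-≤1 {suc m} {f} f≤1 unique with f zero | f≤1 zero | unique zero
... | zero  | _ | _ = ∑-≤1 (f≤1 ∘ suc) λ i j fᵢ>0 fⱼ>0 → suc-injectiveᶠ (unique (suc i) (suc j) fᵢ>0 fⱼ>0)
... | suc _ | s≤s z≤n | unique₀ = ≤-reflexive (cong suc (∑-zero rest≡0))
  where
  rest≡0 : ∀ i → f (suc i) ≡ 0
  rest≡0 i with f (suc i) | unique₀ (suc i)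
  ... | zero  | _ = refl
  ... | suc _ | 0≡suc = case 0≡suc (s≤s z≤n) (s≤s z≤n) of λ ()

δ : ∀ {m} → Fin m → Fin m → ℕ
δ zero    zero    = 1
δ zero    (suc _) = 0
δ (suc _) zero    = 0
δ (suc u) (suc v) = δ u v

δ-≤1 : ∀ {m} (u v : Fin m) → δ u v ≤ 1
δ-≤1 zero    zero    = ≤-refl
δ-≤1 zero    (suc v) = z≤n
δ-≤1 (suc u) zero    = z≤n
δ-≤1 (suc u) (suc v) = δ-≤1 u v

δ-≡ : ∀ {m} {u v : Fin m} → u ≡ v → δ u v ≡ 1
δ-≡ {u = zero}  refl = refl
δ-≡ {u = suc u} refl = δ-≡ {u = u} refl

δ-pos⇒≡ : ∀ {m} {u v : Fin m} → 0 < δ u v → u ≡ v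
δ-pos⇒≡ {u = zero}  {zero}  _    = refl
δ-pos⇒≡ {u = suc u} {suc v} δ>0 = cong suc (δ-pos⇒≡ δ>0)

∑-δ : ∀ {m} (u : Fin m) (h : Fin m → ℕ) → ∑[ v < m ] (δ u v * h v) ≡ h u
∑-δ {suc m} zero h = begin
  1 * h zero + ∑[ v < m ] (0 * h (suc v)) ≡⟨ cong (1 * h zero +_) (∑-zero {f = λ v → 0 * h (suc v)} λ _ → refl) ⟩
  1 * h zero + 0                          ≡⟨ +-identityʳ _ ⟩
  1 * h zero                              ≡⟨ *-identityˡ _ ⟩
  h zero                                  ∎
  where open ≡-Reasoning
∑-δ (suc u) h = ∑-δ u (h ∘ suc)

multiplicity : ∀ {a m} → (Fin a → Fin m) → Fin m → ℕ
multiplicity {a} c v = ∑[ j < a ] δ (c j) v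

∑-∘ : ∀ {a m} (c : Fin a → Fin m) (h : Fin m → ℕ) →
  ∑[ j < a ] h (c j) ≡ ∑[ v < m ] (multiplicity c v * h v)
∑-∘ {a} {m} c h = begin
  ∑[ j < a ] h (c j)                        ≡⟨ ∑-cong (λ j → ∑-δ (c j) h) ⟨
  ∑[ j < a ] ∑[ v < m ] (δ (c j) v * h v)   ≡⟨ ∑-comm (λ j v → δ (c j) v * h v) ⟩
  ∑[ v < m ] ∑[ j < a ] (δ (c j) v * h v)   ≡⟨ ∑-cong (λ v → *-distribʳ-sum (h v) (λ j → δ (c j) v)) ⟨
  ∑[ v < m ] (multiplicity c v * h v)       ∎
  where open ≡-Reasoning

multiplicity-pos : ∀ {a m} (c : Fin a → Fin m) {v} → 0 < multiplicity c v → ∃[ j ] c j ≡ v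
multiplicity-pos c mult>0 with ∑-pos _ mult>0
... | j , δ>0 = j , δ-pos⇒≡ δ>0

multiplicity-injective : ∀ {a m} {c : Fin a → Fin m} → Injective _≡_ _≡_ c → ∀ v → multiplicity c v ≤ 1
multiplicity-injective {c = c} c-inj v = ∑-≤1 (λ j → δ-≤1 (c j) v)
  λ i j δᵢ>0 δⱼ>0 → c-inj (trans (δ-pos⇒≡ δᵢ>0) (sym (δ-pos⇒≡ δⱼ>0)))

∑-weighted-≤ : ∀ {a m} (w : Fin a → Fin m → ℕ) (h : Fin m → ℕ) → (∀ v → ∑[ i < a ] w i v ≤ 1) →
  ∑[ i < a ] ∑[ v < m ] (w i v * h v) ≤ ∑ h
∑-weighted-≤ {a} {m} w h w≤1 = begin
  ∑[ i < a ] ∑[ v < m ] (w i v * h v)   ≡⟨ ∑-comm (λ i v → w i v * h v) ⟩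
  ∑[ v < m ] ∑[ i < a ] (w i v * h v)   ≡⟨ ∑-cong (λ v → *-distribʳ-sum (h v) (λ i → w i v)) ⟨
  ∑[ v < m ] (∑[ i < a ] w i v * h v)   ≤⟨ ∑-mono-≤ (λ v → *-monoˡ-≤ (h v) (w≤1 v)) ⟩
  ∑[ v < m ] (1 * h v)                  ≡⟨ ∑-cong (λ v → *-identityˡ (h v)) ⟩
  ∑ h                                   ∎
  where open ≤-Reasoning

∑∑-disjoint-images-≤ : ∀ {r m} {k : Fin r → ℕ} (c : ∀ i → Fin (k i) → Fin m) →
  (∀ i → Injective _≡_ _≡_ (c i)) → (∀ {i i′ j j′} → c i j ≡ c i′ j′ → i ≡ i′) →
  (h : Fin m → ℕ) → ∑[ i < r ] ∑[ j < k i ] h (c i j) ≤ ∑ h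
∑∑-disjoint-images-≤ {r} {m} {k} c c-inj c-disjoint h = begin
  ∑[ i < r ] ∑[ j < k i ] h (c i j)                 ≡⟨ ∑-cong (λ i → ∑-∘ (c i) h) ⟩
  ∑[ i < r ] ∑[ v < m ] (multiplicity (c i) v * h v) ≤⟨ ∑-weighted-≤ (multiplicity ∘ c) h total≤1 ⟩
  ∑ h                                               ∎
  where
  open ≤-Reasoning
  total≤1 : ∀ v → ∑[ i < r ] multiplicity (c i) v ≤ 1
  total≤1 v = ∑-≤1 (λ i → multiplicity-injective (c-inj i) v) λ i i′ μᵢ>0 μᵢ′>0 →
    c-disjoint (trans (proj₂ (multiplicity-pos (c i) μᵢ>0)) (sym (proj₂ (multiplicity-pos (c i′) μᵢ′>0))))

⟨$⟩ʳ-injective : ∀ {m} (π : Permutation′ m) → Injective _≡_ _≡_ (π ⟨$⟩ʳ_)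
⟨$⟩ʳ-injective π πa≡πb = trans (sym (inverseˡ π)) (trans (cong (π ⟨$⟩ˡ_) πa≡πb) (inverseˡ π))

next-≢ : ∀ {k} → 2 ≤ k → (j : Fin k) → next j ≢ j
next-≢ {suc k} k≥2 j next≡j with suc (toℕ j) <? suc k
... | yes j+1<k = 1+n≢n (trans (sym (toℕ-fromℕ< j+1<k)) (cong toℕ next≡j))
... | no  j+1≮k = j+1≮k (subst (λ i → suc (toℕ i) < suc k) next≡j k≥2)

cycle-support : ∀ {m k} {π : Permutation′ m} (C : IsCycle π k) {x} → π ⟨$⟩ʳ x ≢ x → ∃[ j ] proj₁ C j ≡ x
cycle-support (c , _ , _ , c-fixes) {x} πx≢x with any? (λ j → c j ≟ᶠ x)
... | yes found = found
... | no  none  = contradiction (c-fixes x λ j cⱼ≡x → none (j , cⱼ≡x)) πx≢x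

cycle-moves : ∀ {m k} {π : Permutation′ m} → 2 ≤ k → (C : IsCycle π k) →
  ∀ j → π ⟨$⟩ʳ proj₁ C j ≢ proj₁ C j
cycle-moves k≥2 (c , c-inj , c-step , _) j πcⱼ≡cⱼ = next-≢ k≥2 j (c-inj (trans (sym (c-step j)) πcⱼ≡cⱼ))

orbit₃ : (j₀ j : Fin 3) → j ≡ j₀ ⊎ j ≡ next j₀ ⊎ j ≡ next (next j₀)
orbit₃ zero             zero             = inj₁ refl
orbit₃ zero             (suc zero)       = inj₂ (inj₁ refl)
orbit₃ zero             (suc (suc zero)) = inj₂ (inj₂ refl)
orbit₃ (suc zero)       zero             = inj₂ (inj₂ refl)
orbit₃ (suc zero)       (suc zero)       = inj₁ refl
orbit₃ (suc zero)       (suc (suc zero)) = inj₂ (inj₁ refl)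
orbit₃ (suc (suc zero)) zero             = inj₂ (inj₁ refl)
orbit₃ (suc (suc zero)) (suc zero)       = inj₂ (inj₂ refl)
orbit₃ (suc (suc zero)) (suc (suc zero)) = inj₁ refl

three-cycle-support : ∀ {m} {π : Permutation′ m} → IsCycle π 3 →
  ∀ {x z} → π ⟨$⟩ʳ x ≢ x → π ⟨$⟩ʳ z ≢ z →
  z ≡ x ⊎ z ≡ π ⟨$⟩ʳ x ⊎ z ≡ π ⟨$⟩ʳ (π ⟨$⟩ʳ x)
three-cycle-support {π = π} C@(c , _ , c-step , _) πx≢x πz≢z
  with cycle-support {π = π} C πx≢x | cycle-support {π = π} C πz≢z
... | jx , refl | jz , refl with orbit₃ jx jz
... | inj₁ refl        = inj₁ refl
... | inj₂ (inj₁ refl) = inj₂ (inj₁ (sym (c-step jx)))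
... | inj₂ (inj₂ refl) = inj₂ (inj₂ (sym (trans (cong (π ⟨$⟩ʳ_) (c-step jx)) (c-step (next jx)))))

PairwiseDisjoint : ∀ {n r} → (Fin r → Permutation′ n) → Set
PairwiseDisjoint τ = ∀ i j → i ≢ j → ∀ x → τ i ⟨$⟩ʳ x ≢ x → τ j ⟨$⟩ʳ x ≡ x

disjoint-supports : ∀ {n r} {τ : Fin r → Permutation′ n} → PairwiseDisjoint τ →
  ∀ {i i′ x} → τ i ⟨$⟩ʳ x ≢ x → τ i′ ⟨$⟩ʳ x ≢ x → i ≡ i′
disjoint-supports τ-disjoint {i} {i′} {x} τᵢx≢x τᵢ′x≢x with i ≟ᶠ i′
... | yes i≡i′ = i≡i′
... | no  i≢i′ = contradiction (τ-disjoint i i′ i≢i′ x τᵢx≢x) τᵢ′x≢x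

applyProd-fixed : ∀ {n r} (τ : Fin r → Permutation′ n) {x} → (∀ i → τ i ⟨$⟩ʳ x ≡ x) →
  applyProd (tabulate τ) x ≡ x
applyProd-fixed {r = zero}  τ τx≡x = refl
applyProd-fixed {r = suc r} τ τx≡x =
  trans (cong (τ zero ⟨$⟩ʳ_) (applyProd-fixed (τ ∘ suc) (τx≡x ∘ suc))) (τx≡x zero)

applyProd-disjoint : ∀ {n r} {τ : Fin r → Permutation′ n} → PairwiseDisjoint τ →
  ∀ i {x} → τ i ⟨$⟩ʳ x ≢ x → applyProd (tabulate τ) x ≡ τ i ⟨$⟩ʳ x
applyProd-disjoint {τ = τ} τ-disjoint zero {x} τ₀x≢x =
  cong (τ zero ⟨$⟩ʳ_) (applyProd-fixed (τ ∘ suc) λ i → τ-disjoint zero (suc i) (λ ()) x τ₀x≢x)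
applyProd-disjoint {τ = τ} τ-disjoint (suc i) {x} τᵢx≢x = begin
  τ zero ⟨$⟩ʳ applyProd (tabulate (τ ∘ suc)) x
    ≡⟨ cong (τ zero ⟨$⟩ʳ_) (applyProd-disjoint τ∘suc-disjoint i τᵢx≢x) ⟩
  τ zero ⟨$⟩ʳ (τ (suc i) ⟨$⟩ʳ x)              ≡⟨ τ-disjoint (suc i) zero (λ ()) _ τᵢ-moves-τᵢx ⟩
  τ (suc i) ⟨$⟩ʳ x                             ∎
  where
  open ≡-Reasoning
  τ∘suc-disjoint : PairwiseDisjoint (τ ∘ suc)
  τ∘suc-disjoint i j i≢j = τ-disjoint (suc i) (suc j) (i≢j ∘ suc-injectiveᶠ)
  τᵢ-moves-τᵢx : τ (suc i) ⟨$⟩ʳ (τ (suc i) ⟨$⟩ʳ x) ≢ τ (suc i) ⟨$⟩ʳ x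
  τᵢ-moves-τᵢx = τᵢx≢x ∘ ⟨$⟩ʳ-injective (τ (suc i))

moved : ∀ {m} → Permutation′ m → Fin m → ℕ
moved t x with t ⟨$⟩ʳ x ≟ᶠ x
... | yes _ = 0
... | no  _ = 1

moved-fixed : ∀ {m} {t : Permutation′ m} {x} → t ⟨$⟩ʳ x ≡ x → moved t x ≡ 0
moved-fixed {t = t} {x} tx≡x with t ⟨$⟩ʳ x ≟ᶠ x
... | yes _    = refl
... | no tx≢x = contradiction tx≡x tx≢x

movers : ∀ {m} → List (Permutation′ m) → Fin m → ℕ
movers ts x = sum (map (λ t → moved t x) ts)

applyProd-++ : ∀ {m} (ts us : List (Permutation′ m)) x → applyProd (ts ++ us) x ≡ applyProd ts (applyProd us x)
applyProd-++ []       us x = refl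
applyProd-++ (t ∷ ts) us x = cong (t ⟨$⟩ʳ_) (applyProd-++ ts us x)

movers-take-drop : ∀ {m} i (ts : List (Permutation′ m)) x → movers (take i ts) x + movers (drop i ts) x ≡ movers ts x
movers-take-drop i ts x = begin
  movers (take i ts) x + movers (drop i ts) x    ≡⟨ sum-++ (map _ (take i ts)) _ ⟨
  sum (map _ (take i ts) ++ map _ (drop i ts))    ≡⟨ cong sum (map-++ _ (take i ts) _) ⟨
  movers (take i ts ++ drop i ts) x               ≡⟨ cong (λ us → movers us x) (take++drop≡id i ts) ⟩
  movers ts x                                     ∎
  where open ≡-Reasoning

movers-drop-≤ : ∀ {m} {i j} (ts : List (Permutation′ m)) x → i ≤ j → movers (drop j ts) x ≤ movers (drop i ts) x
movers-drop-≤ {i = i} {j} ts x i≤j = begin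
  movers (drop j ts) x                         ≡⟨ cong (λ l → movers (drop l ts) x) (m+[n∸m]≡n i≤j) ⟨
  movers (drop (i + (j ∸ i)) ts) x             ≡⟨ cong (λ us → movers us x) (drop-drop i (j ∸ i) ts) ⟨
  movers (drop (j ∸ i) (drop i ts)) x          ≤⟨ m≤n+m _ _ ⟩
  movers (take (j ∸ i) (drop i ts)) x + _      ≡⟨ movers-take-drop (j ∸ i) (drop i ts) x ⟩
  movers (drop i ts) x                         ∎
  where open ≤-Reasoning

unmoved-fixed : ∀ {m} (ts : List (Permutation′ m)) {x} → movers ts x ≡ 0 → applyProd ts x ≡ x
unmoved-fixed []       _ = refl
unmoved-fixed (t ∷ ts) {x} unmoved with t ⟨$⟩ʳ x ≟ᶠ x
... | yes tx≡x = trans (cong (t ⟨$⟩ʳ_) (unmoved-fixed ts unmoved)) tx≡x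

unmoved-preimage : ∀ {m} (ts : List (Permutation′ m)) {x y} → movers ts x ≡ 0 → applyProd ts y ≡ x → y ≡ x
unmoved-preimage []       _ ts[y]≡x = ts[y]≡x
unmoved-preimage (t ∷ ts) {x} unmoved ts[y]≡x with t ⟨$⟩ʳ x ≟ᶠ x
... | yes tx≡x = unmoved-preimage ts unmoved (⟨$⟩ʳ-injective t (trans ts[y]≡x (sym tx≡x)))

record MovedOnce {m} (ts : List (Permutation′ m)) (x : Fin m) : Set where
  field
    position      : ℕ
    mover         : Permutation′ m
    split         : drop position ts ≡ mover ∷ drop (suc position) ts
    mover-moves   : mover ⟨$⟩ʳ x ≢ x
    unmoved-left  : movers (take position ts) x ≡ 0
    unmoved-right : movers (drop (suc position) ts) x ≡ 0

movedOnce : ∀ {m} (ts : List (Permutation′ m)) {x} → movers ts x ≡ 1 → MovedOnce ts x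
movedOnce (t ∷ ts) {x} once with t ⟨$⟩ʳ x ≟ᶠ x
... | yes tx≡x = record
  { position      = suc position
  ; mover         = mover
  ; split         = split
  ; mover-moves   = mover-moves
  ; unmoved-left  = trans (cong (_+ movers (take position ts) x) (moved-fixed tx≡x)) unmoved-left
  ; unmoved-right = unmoved-right
  }
  where open MovedOnce (movedOnce ts once)
... | no tx≢x = record
  { position      = 0
  ; mover         = t
  ; split         = refl
  ; mover-moves   = tx≢x
  ; unmoved-left  = refl
  ; unmoved-right = suc-injective once
  }

module _ {m} {ts : List (Permutation′ m)} where
  open MovedOnce

  suffix-maps : ∀ {a p} (P : MovedOnce ts p) → applyProd ts a ≡ p → applyProd (drop (position P) ts) a ≡ p
  suffix-maps {a} P ts[a]≡p = unmoved-preimage (take (position P) ts) (unmoved-left P) (begin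
    applyProd (take (position P) ts) (applyProd (drop (position P) ts) a)
      ≡⟨ applyProd-++ (take (position P) ts) _ a ⟨
    applyProd (take (position P) ts ++ drop (position P) ts) a
      ≡⟨ cong (λ us → applyProd us a) (take++drop≡id (position P) ts) ⟩
    applyProd ts a
      ≡⟨ ts[a]≡p ⟩
    _ ∎)
    where open ≡-Reasoning

  position-≤ : ∀ {a p} (A : MovedOnce ts a) (P : MovedOnce ts p) → applyProd ts a ≡ p → p ≢ a →
    position P ≤ position A
  position-≤ {a} A P ts[a]≡p p≢a with position P ≤? position A
  ... | yes P≤A = P≤A
  ... | no  P≰A = contradiction
    (trans (sym (suffix-maps P ts[a]≡p)) (unmoved-fixed (drop (position P) ts) suffix-unmoved)) p≢a
    where
    suffix-unmoved : movers (drop (position P) ts) a ≡ 0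
    suffix-unmoved = n≤0⇒n≡0 (≤-trans (movers-drop-≤ ts a (≰⇒> P≰A)) (≤-reflexive (unmoved-right A)))

  same-position : ∀ {a p} (A : MovedOnce ts a) (P : MovedOnce ts p) → applyProd ts a ≡ p →
    position A ≡ position P → mover P ⟨$⟩ʳ a ≡ p
  same-position {a} A P ts[a]≡p A≡P = begin
    mover P ⟨$⟩ʳ a                                                ≡⟨ cong (mover P ⟨$⟩ʳ_) after-P-fixes-a ⟨
    mover P ⟨$⟩ʳ applyProd (drop (suc (position P)) ts) a          ≡⟨ cong (λ us → applyProd us a) (split P) ⟨
    applyProd (drop (position P) ts) a                             ≡⟨ suffix-maps P ts[a]≡p ⟩
    _                                                              ∎
    where
    open ≡-Reasoning
    after-P-fixes-a : applyProd (drop (suc (position P)) ts) a ≡ a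
    after-P-fixes-a = unmoved-fixed (drop (suc (position P)) ts)
      (subst (λ i → movers (drop (suc i) ts) a ≡ 0) A≡P (unmoved-right A))

  same-mover : ∀ {a p} (A : MovedOnce ts a) (P : MovedOnce ts p) → position A ≡ position P → mover A ≡ mover P
  same-mover A P A≡P = ∷-injectiveˡ (trans (sym (split A)) (trans (cong (λ i → drop i ts) A≡P) (split P)))

  All-mover : ∀ {P : Permutation′ m → Set} {x} → All P ts → (X : MovedOnce ts x) → P (mover X)
  All-mover all X with subst (All _) (split X) (drop⁺ (position X) all)
  ... | P-mover ∷ _ = P-mover

argmax : ∀ {k} (f : Fin (suc k) → ℕ) → ∃[ j₀ ] ∀ j → f j ≤ f j₀
argmax {zero}  f = zero , λ { zero → ≤-refl }
argmax {suc k} f with argmax (f ∘ suc)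
... | j₁ , f∘suc≤fj₁ with f zero ≤? f (suc j₁)
...   | yes f₀≤ = suc j₁ , λ { zero → f₀≤ ; (suc j) → f∘suc≤fj₁ j }
...   | no  f₀≰ = zero , λ { zero → ≤-refl ; (suc j) → ≤-trans (f∘suc≤fj₁ j) (<⇒≤ (≰⇒> f₀≰)) }

-- At a maximum of s, monotonicity along the cycle forces two equal steps.
cyclic-mono-stationary : ∀ {k} → 0 < k → (s : Fin k → ℕ) → (∀ j → s j ≤ s (next j)) →
  ∃[ j ] s (next j) ≡ s j × s (next (next j)) ≡ s (next j)
cyclic-mono-stationary {suc k} _ s s-mono with argmax s
... | j , s≤sⱼ = j , step₁ , ≤-antisym (≤-trans (s≤sⱼ _) (≤-reflexive (sym step₁))) (s-mono (next j))
  where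
  step₁ : s (next j) ≡ s j
  step₁ = ≤-antisym (s≤sⱼ (next j)) (s-mono j)

↑ˡ≢↑ʳ : ∀ {n d} (p : Fin n) (y : Fin d) → p ↑ˡ d ≢ n ↑ʳ y
↑ˡ≢↑ʳ {n} {d} p y p≡y =
  case trans (sym (splitAt-↑ˡ n p d)) (trans (cong (splitAt n) p≡y) (splitAt-↑ʳ n d y)) of λ ()

NewThreeCycle : ∀ n d → Permutation′ (n + d) → Set
NewThreeCycle n d t = IsCycle t 3 × Σ (Fin d) λ y → t ⟨$⟩ʳ (n ↑ʳ y) ≢ n ↑ʳ y

moved-old-≤2 : ∀ {n d} {t : Permutation′ (n + d)} → NewThreeCycle n d t → ∑[ p < n ] moved t (p ↑ˡ d) ≤ 2
moved-old-≤2 {n} {d} {t} (C , y , t-moves-y) = begin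
  ∑[ p < n ] moved t (p ↑ˡ d)                         ≤⟨ ∑-mono-≤ moved≤ ⟩
  ∑[ p < n ] (δ (p ↑ˡ d) u + δ (p ↑ˡ d) v)            ≡⟨ ∑-distrib-+ (λ p → δ (p ↑ˡ d) u) _ ⟩
  multiplicity (_↑ˡ d) u + multiplicity (_↑ˡ d) v     ≤⟨ +-mono-≤ (multiplicity-injective ↑ˡ-inj u)
                                                                   (multiplicity-injective ↑ˡ-inj v) ⟩
  2                                                   ∎
  where
  open ≤-Reasoning
  u = t ⟨$⟩ʳ (n ↑ʳ y)
  v = t ⟨$⟩ʳ u
  ↑ˡ-inj : Injective _≡_ _≡_ (_↑ˡ d)
  ↑ˡ-inj = ↑ˡ-injective d _ _
  moved≤ : ∀ p → moved t (p ↑ˡ d) ≤ δ (p ↑ˡ d) u + δ (p ↑ˡ d) v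
  moved≤ p with t ⟨$⟩ʳ (p ↑ˡ d) ≟ᶠ p ↑ˡ d
  ... | yes _ = z≤n
  ... | no t-moves-p with three-cycle-support {π = t} C t-moves-y t-moves-p
  ...   | inj₁ p≡y         = contradiction p≡y (↑ˡ≢↑ʳ p y)
  ...   | inj₂ (inj₁ p≡u) = ≤-trans (≤-reflexive (sym (δ-≡ p≡u))) (m≤m+n _ _)
  ...   | inj₂ (inj₂ p≡v) = ≤-trans (≤-reflexive (sym (δ-≡ p≡v))) (m≤n+m _ _)

∑-movers-≤ : ∀ {n d} {ts : List (Permutation′ (n + d))} → All (NewThreeCycle n d) ts →
  ∑[ p < n ] movers ts (p ↑ˡ d) ≤ 2 * length ts
∑-movers-≤ {n} []                = ≤-reflexive (∑-zero {n} (λ _ → refl))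
∑-movers-≤ {n} {d} {t ∷ ts} (t-new ∷ ts-new) = begin
  ∑[ p < n ] (moved t (p ↑ˡ d) + movers ts (p ↑ˡ d))
    ≡⟨ ∑-distrib-+ (λ p → moved t (p ↑ˡ d)) _ ⟩
  ∑[ p < n ] moved t (p ↑ˡ d) + ∑[ p < n ] movers ts (p ↑ˡ d)
    ≤⟨ +-mono-≤ (moved-old-≤2 t-new) (∑-movers-≤ ts-new) ⟩
  2 + 2 * length ts
    ≡⟨ *-suc 2 (length ts) ⟨
  2 * length (t ∷ ts) ∎
  where open ≤-Reasoning

no-old-path : ∀ {n d} {t : Permutation′ (n + d)} → NewThreeCycle n d t → ∀ {p q w : Fin n} →
  t ⟨$⟩ʳ (w ↑ˡ d) ≡ q ↑ˡ d → t ⟨$⟩ʳ (q ↑ˡ d) ≡ p ↑ˡ d → q ≢ w → ⊥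
no-old-path {d = d} {t} (C , y , t-moves-y) {p} {q} {w} w↦q q↦p q≢w
  with three-cycle-support {π = t} C (q≢w ∘ ↑ˡ-injective d q w ∘ trans (sym w↦q)) t-moves-y
... | inj₁ y≡w         = ↑ˡ≢↑ʳ w y (sym y≡w)
... | inj₂ (inj₁ y≡q)  = ↑ˡ≢↑ʳ q y (sym (trans y≡q w↦q))
... | inj₂ (inj₂ y≡p)  = ↑ˡ≢↑ʳ p y (sym (trans y≡p (trans (cong (t ⟨$⟩ʳ_) w↦q) q↦p)))

module _ {n d} {ts : List (Permutation′ (n + d))} (ts-new : All (NewThreeCycle n d) ts)
         {k} (k≥2 : 2 ≤ k) (c : Fin k → Fin n) (c-inj : Injective _≡_ _≡_ c)
         (ts-c : ∀ j → applyProd ts (c (next j) ↑ˡ d) ≡ c j ↑ˡ d) where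

  private
    N : Fin k → ℕ
    N j = movers ts (c j ↑ˡ d)

    c-step-≢ : ∀ j → c j ≢ c (next j)
    c-step-≢ j cⱼ≡cⱼ₊₁ = next-≢ k≥2 j (sym (c-inj cⱼ≡cⱼ₊₁))

    c↑-step-≢ : ∀ j → c j ↑ˡ d ≢ c (next j) ↑ˡ d
    c↑-step-≢ j = c-step-≢ j ∘ ↑ˡ-injective d _ _

    cycle-point-moved : ∀ j → 0 < N j
    cycle-point-moved j = n≢0⇒n>0 λ unmoved →
      c↑-step-≢ j (sym (unmoved-preimage ts unmoved (ts-c j)))

    cycle-not-moved-once : ¬ (∀ j → N j ≡ 1)
    cycle-not-moved-once all-once = stationary⇒⊥ (cyclic-mono-stationary (≤-trans (s≤s z≤n) k≥2) s s-mono)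
      where
      O : ∀ j → MovedOnce ts (c j ↑ˡ d)
      O j = movedOnce ts (all-once j)
      s : Fin k → ℕ
      s j = MovedOnce.position (O j)
      s-mono : ∀ j → s j ≤ s (next j)
      s-mono j = position-≤ (O (next j)) (O j) (ts-c j) (c↑-step-≢ j)
      stationary⇒⊥ : ∃[ j ] s (next j) ≡ s j × s (next (next j)) ≡ s (next j) → ⊥
      stationary⇒⊥ (j , s₁≡s₀ , s₂≡s₁) =
        no-old-path {t = t} (All-mover ts-new (O j)) t[c₂]≡c₁ t[c₁]≡c₀ (c-step-≢ (next j))
        where
        t = MovedOnce.mover (O j)
        t[c₁]≡c₀ : t ⟨$⟩ʳ (c (next j) ↑ˡ d) ≡ c j ↑ˡ d
        t[c₁]≡c₀ = same-position (O (next j)) (O j) (ts-c j) s₁≡s₀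
        t[c₂]≡c₁ : t ⟨$⟩ʳ (c (next (next j)) ↑ˡ d) ≡ c (next j) ↑ˡ d
        t[c₂]≡c₁ = subst (λ t′ → t′ ⟨$⟩ʳ (c (next (next j)) ↑ˡ d) ≡ c (next j) ↑ˡ d)
          (same-mover (O (next j)) (O j) s₁≡s₀)
          (same-position (O (next (next j))) (O (next j)) (ts-c (next j)) s₂≡s₁)

  cycle-movers : suc k ≤ ∑[ j < k ] movers ts (c j ↑ˡ d)
  cycle-movers with any? (λ j → 2 ≤? N j)
  ... | yes (j , Nⱼ≥2) = ∑-positive-with-two cycle-point-moved j Nⱼ≥2
  ... | no  none       = ⊥-elim (cycle-not-moved-once λ j →
          ≤-antisym (≮⇒≥ λ Nⱼ≥2 → none (j , Nⱼ≥2)) (cycle-point-moved j))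

sum-tabulate : ∀ {r} (k : Fin r → ℕ) → sum (tabulate k) ≡ ∑ k
sum-tabulate {zero}  k = refl
sum-tabulate {suc r} k = cong (k zero +_) (sum-tabulate (k ∘ suc))

mainTheorem12 :
    (n r d : ℕ) (σ : Permutation′ n)
    (τ : Fin r → Permutation′ n) (k : Fin r → ℕ) →
    (∀ i → 2 ≤ k i) →
    (∀ i → IsCycle (τ i) (k i)) →
    (∀ i j → i ≢ j → ∀ x → τ i ⟨$⟩ʳ x ≢ x → τ j ⟨$⟩ʳ x ≡ x) →
    sum (tabulate k) ≡ n →
    (∀ x → σ ⟨$⟩ʳ x ≡ applyProd (tabulate τ) x) →
    2 ≤ d →
    (ts : List (Permutation′ (n + d))) →
    All (λ t → IsCycle t 3 × Σ (Fin d) (λ y → t ⟨$⟩ʳ (n ↑ʳ y) ≢ n ↑ʳ y)) ts →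
    (∀ x → applyProd ts (x ↑ˡ d) ≡ (σ ⟨$⟩ˡ x) ↑ˡ d) →
    (∀ y → applyProd ts (n ↑ʳ y) ≡ n ↑ʳ y) →
    n + r ≤ 2 * length ts
mainTheorem12 n r d σ τ k k≥2 τ-cycle τ-disjoint ∑k≡n σ≡∏τ _ ts ts-new ts-inverts _ = begin
  n + r                                            ≡⟨ cong (_+ r) (trans (sym ∑k≡n) (sum-tabulate k)) ⟩
  ∑ k + r                                          ≡⟨ +-comm (∑ k) r ⟩
  r + ∑ k                                          ≡⟨ ∑-suc k ⟨
  ∑[ i < r ] suc (k i)                             ≤⟨ ∑-mono-≤ (λ i → cycle-movers ts-new (k≥2 i) (c i) (c-inj i) (ts-c i)) ⟩
  ∑[ i < r ] ∑[ j < k i ] movers ts (c i j ↑ˡ d)   ≤⟨ ∑∑-disjoint-images-≤ c c-inj c-disjoint N ⟩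
  ∑ N                                              ≤⟨ ∑-movers-≤ ts-new ⟩
  2 * length ts                                    ∎
  where
  open ≤-Reasoning
  N : Fin n → ℕ
  N p = movers ts (p ↑ˡ d)
  c : ∀ i → Fin (k i) → Fin n
  c i = proj₁ (τ-cycle i)
  c-inj : ∀ i → Injective _≡_ _≡_ (c i)
  c-inj i = proj₁ (proj₂ (τ-cycle i))
  c-step : ∀ i j → τ i ⟨$⟩ʳ c i j ≡ c i (next j)
  c-step i = proj₁ (proj₂ (proj₂ (τ-cycle i)))
  c-moved : ∀ i j → τ i ⟨$⟩ʳ c i j ≢ c i j
  c-moved i = cycle-moves {π = τ i} (k≥2 i) (τ-cycle i)
  c-disjoint : ∀ {i i′ j j′} → c i j ≡ c i′ j′ → i ≡ i′
  c-disjoint {i} {i′} {j} {j′} cᵢⱼ≡cᵢ′ⱼ′ =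
    disjoint-supports {τ = τ} τ-disjoint (c-moved i j)
      (subst (λ x → τ i′ ⟨$⟩ʳ x ≢ x) (sym cᵢⱼ≡cᵢ′ⱼ′) (c-moved i′ j′))
  σ-c : ∀ i j → σ ⟨$⟩ʳ c i j ≡ c i (next j)
  σ-c i j = trans (σ≡∏τ (c i j)) (trans (applyProd-disjoint τ-disjoint i (c-moved i j)) (c-step i j))
  ts-c : ∀ i j → applyProd ts (c i (next j) ↑ˡ d) ≡ c i j ↑ˡ d
  ts-c i j = trans (ts-inverts (c i (next j))) (cong (_↑ˡ d) (trans (cong (σ ⟨$⟩ˡ_) (sym (σ-c i j))) (inverseˡ σ)))
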